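{- Let $q$ be a prime power, $t\ge2$, $n=2t$, $s$ a positive integer coprime with $n$, $\delta\in\mathbb{F}_{q^{2t}}$ with $\mathrm{N}_{q^{2t}/q^t}(\delta)=\delta^{q^t+1}\neq1$, and $f(x)=\delta x^{q^s}+x^{q^{t+s}}\in\mathbb{F}_{q^{2t}}[x]$. Then $f(x)$ is R-$q^t$-partially scattered.
   Context: A $q$-polynomial $f$ over $\mathbb{F}_{q^n}$ is R-$q^t$-partially scattered if for all $y,z\in\mathbb{F}_{q^n}^*$, $f(y)/y=f(z)/z$ and $y/z\in\mathbb{F}_{q^t}$ imply $y/z\in\mathbb{F}_q$. -}

module Defs where

open import Level using (Level; _⊔_)
open import Data.Nat using (ℕ; zero; suc; _≤_)
open import Data.Nat.Primality using (Prime)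
open import Data.Fin using (Fin)
open import Data.Product using (Σ; _×_; ∃)
open import Relation.Nullary using (¬_)
open import Relation.Binary.PropositionalEquality using (_≡_) renaming (setoid to ≡-setoid)
open import Algebra.Bundles using (CommutativeRing)
open import Function.Bundles using (Bijection)

IsPrimePower : ℕ → Set
IsPrimePower q = Σ ℕ λ p → Σ ℕ λ k → Prime p × 1 ≤ k × q ≡ p Data.Nat.^ k

record Field (c ℓ : Level) : Set (Level.suc (c ⊔ ℓ)) where
  field
    commutativeRing : CommutativeRing c ℓ
  open CommutativeRing commutativeRing public
  field
    _⁻¹     : Carrier → Carrier
    1#≉0#   : ¬ (1# ≈ 0#)
    inverse : ∀ x → ¬ (x ≈ 0#) → x * (x ⁻¹) ≈ 1#
  infix 8 _⁻¹

module _ {c ℓ} (K : Field c ℓ) where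
  open Field K

  pow : Carrier → ℕ → Carrier
  pow x zero    = 1#
  pow x (suc n) = x * pow x n

  HasCard : ℕ → Set (c ⊔ ℓ)
  HasCard N = Bijection (≡-setoid (Fin N)) setoid

  -- membership in the subfield F_{q^m} of K: fixed points of x ↦ x^(q^m)
  InSubfield : ℕ → ℕ → Carrier → Set ℓ
  InSubfield q m x = pow x (q Data.Nat.^ m) ≈ x

  RPartiallyScattered : ℕ → ℕ → (Carrier → Carrier) → Set (c ⊔ ℓ)
  RPartiallyScattered q t f =
    ∀ (y z : Carrier) → ¬ (y ≈ 0#) → ¬ (z ≈ 0#) →
      f y * (y ⁻¹) ≈ f z * (z ⁻¹) →
      InSubfield q t (y * (z ⁻¹)) →
      InSubfield q 1 (y * (z ⁻¹))

-- Write μ = y/z ∈ F_{q^t}.  Since μ^{q^{t+s}} = μ^{q^s}, f(y) = f(μz) = μ^{q^s} f(z), while the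
-- hypothesis says f(y) = μ f(z).  If f(z) ≠ 0 then μ^{q^s} = μ, so μ lies in F_{q^s} ∩ F_{q^t} = F_q
-- as gcd(s, t) = 1.  If f(z) = 0, then w = z^{q^s} satisfies w^{q^t} = -δw; raising to the power q^t + 1
-- and using w^{q^{2t}} = w gives N(δ) = δ^{q^t+1} = 1, which is excluded.
module Submission where

open import Defs
open import Data.Nat using (ℕ; zero; suc; NonZero; _+_; _*_; _^_; _≤_)
import Data.Nat.Properties as ℕ
open import Data.Nat.Coprimality using (Coprime; coprime-Bézout)
open import Data.Nat.Divisibility using (∣-trans; n∣m*n)
open import Data.Nat.GCD using (module Bézout)
open import Data.Fin using (Fin; punchIn; _≟_)
open import Data.Fin.Properties using (punchInᵢ≢i)
open import Data.Fin.Permutation as Permutation using (Permutation; permutation; _⟨$⟩ʳ_)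
open import Data.Product using (_,_; proj₁; proj₂)
open import Data.Sum using (_⊎_; inj₁; inj₂)
open import Relation.Nullary using (¬_; yes; no)
open import Relation.Binary.PropositionalEquality as ≡ using (_≡_)
open import Data.Vec.Functional using (replicate)
open import Function.Base using (_∘_)
open import Function.Bundles using (Bijection)
import Algebra.Properties.Ring as RingProperties
import Algebra.Properties.CommutativeSemigroup as CommutativeSemigroupProperties
import Algebra.Properties.CommutativeSemiring.Exp as ExpProperties
import Algebra.Properties.CommutativeMonoid.Sum as SumProperties

module FieldProperties {c ℓ} (K : Field c ℓ) where
  open Field K hiding (zero) renaming (_+_ to _⊕_; _*_ to _·_)
  open RingProperties ring using (-1*x≈-x; -‿involutive; +-inverseʳ-unique)
  open CommutativeSemigroupProperties *-commutativeSemigroup using (x∙yz≈y∙xz)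
  open ExpProperties commutativeSemiring using (^-congˡ; ^-homo-*; ^-assocʳ; ^-distrib-*)
    renaming (_^_ to _^ᴷ_)
  open SumProperties *-commutativeMonoid using ()
    renaming (sum to product; sum-permute to product-permute;
              ∑-distrib-+ to product-distrib; sum-replicate to product-replicate;
              sum-cong-≋ to product-cong)
  open import Relation.Binary.Reasoning.Setoid setoid

  pow≡^ : ∀ x n → pow K x n ≡ x ^ᴷ n
  pow≡^ x zero    = ≡.refl
  pow≡^ x (suc n) = ≡.cong (x ·_) (pow≡^ x n)

  pow-congˡ : ∀ n {x y} → x ≈ y → pow K x n ≈ pow K y n
  pow-congˡ n {x} {y} x≈y rewrite pow≡^ x n | pow≡^ y n = ^-congˡ n x≈y

  pow-homo-* : ∀ x m n → pow K x (m + n) ≈ pow K x m · pow K x n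
  pow-homo-* x m n rewrite pow≡^ x (m + n) | pow≡^ x m | pow≡^ x n = ^-homo-* x m n

  pow-assocʳ : ∀ x m n → pow K (pow K x m) n ≈ pow K x (m * n)
  pow-assocʳ x m n rewrite pow≡^ (pow K x m) n | pow≡^ x m | pow≡^ x (m * n) = ^-assocʳ x m n

  pow-distrib-* : ∀ x y n → pow K (x · y) n ≈ pow K x n · pow K y n
  pow-distrib-* x y n rewrite pow≡^ (x · y) n | pow≡^ x n | pow≡^ y n = ^-distrib-* x y n

  pow-identityʳ : ∀ x → pow K x 1 ≈ x
  pow-identityʳ = *-identityʳ

  1#-pow : ∀ n → pow K 1# n ≈ 1#
  1#-pow zero    = refl
  1#-pow (suc n) = trans (*-identityˡ _) (1#-pow n)

  -1-pow : ∀ n → pow K (- 1#) n ≈ 1# ⊎ pow K (- 1#) n ≈ - 1#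
  -1-pow zero = inj₁ refl
  -1-pow (suc n) with -1-pow n
  ... | inj₁ ≈1  = inj₂ (trans (*-congˡ ≈1) (*-identityʳ _))
  ... | inj₂ ≈-1 = inj₁ (trans (*-congˡ ≈-1) (trans (-1*x≈-x _) (-‿involutive 1#)))

  *-cancelʳ : ∀ {x y z} → ¬ z ≈ 0# → x · z ≈ y · z → x ≈ y
  *-cancelʳ {x} {y} {z} z≉0 xz≈yz = begin
    x                ≈⟨ *-identityʳ x ⟨
    x · 1#           ≈⟨ *-congˡ (inverse z z≉0) ⟨
    x · (z · z ⁻¹)   ≈⟨ *-assoc x z (z ⁻¹) ⟨
    (x · z) · z ⁻¹   ≈⟨ *-congʳ xz≈yz ⟩
    (y · z) · z ⁻¹   ≈⟨ *-assoc y z (z ⁻¹) ⟩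
    y · (z · z ⁻¹)   ≈⟨ *-congˡ (inverse z z≉0) ⟩
    y · 1#           ≈⟨ *-identityʳ y ⟩
    y                ∎

  *-≉0 : ∀ {x y} → ¬ x ≈ 0# → ¬ y ≈ 0# → ¬ x · y ≈ 0#
  *-≉0 {x} {y} x≉0 y≉0 xy≈0 = x≉0 (*-cancelʳ y≉0 (trans xy≈0 (sym (zeroˡ y))))

  pow-≉0 : ∀ {x} → ¬ x ≈ 0# → ∀ n → ¬ pow K x n ≈ 0#
  pow-≉0 x≉0 zero    = 1#≉0#
  pow-≉0 x≉0 (suc n) = *-≉0 x≉0 (pow-≉0 x≉0 n)

  product-≉0 : ∀ {n} (f : Fin n → Carrier) → (∀ i → ¬ f i ≈ 0#) → ¬ product f ≈ 0#
  product-≉0 {zero}  f f≉0 = 1#≉0#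
  product-≉0 {suc n} f f≉0 = *-≉0 (f≉0 Fin.zero) (product-≉0 (f ∘ Fin.suc) (f≉0 ∘ Fin.suc))

  x≈[x*z⁻¹]*z : ∀ {x z} → ¬ z ≈ 0# → x ≈ (x · z ⁻¹) · z
  x≈[x*z⁻¹]*z {x} {z} z≉0 = begin
    x                ≈⟨ *-identityʳ x ⟨
    x · 1#           ≈⟨ *-congˡ (trans (*-comm _ _) (inverse z z≉0)) ⟨
    x · (z ⁻¹ · z)   ≈⟨ *-assoc x (z ⁻¹) z ⟨
    (x · z ⁻¹) · z   ∎

  quotients-equal⇒ : ∀ {a b y z} → ¬ y ≈ 0# → a · y ⁻¹ ≈ b · z ⁻¹ → a ≈ (y · z ⁻¹) · b
  quotients-equal⇒ {a} {b} {y} {z} y≉0 a/y≈b/z = begin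
    a                  ≈⟨ x≈[x*z⁻¹]*z y≉0 ⟩
    (a · y ⁻¹) · y     ≈⟨ *-congʳ a/y≈b/z ⟩
    (b · z ⁻¹) · y     ≈⟨ *-assoc b (z ⁻¹) y ⟩
    b · (z ⁻¹ · y)     ≈⟨ *-congˡ (*-comm (z ⁻¹) y) ⟩
    b · (y · z ⁻¹)     ≈⟨ *-comm b _ ⟩
    (y · z ⁻¹) · b     ∎

  module Finite {n} (card : HasCard K (suc n)) where
    open Bijection card using (strictlySurjective; injective) renaming (to to element)

    index : Carrier → Fin (suc n)
    index x = proj₁ (strictlySurjective x)

    element-index : ∀ x → element (index x) ≈ x
    element-index x = proj₂ (strictlySurjective x)

    index-cong : ∀ {x y} → x ≈ y → index x ≡ index y
    index-cong {x} {y} x≈y = injective (trans (element-index x) (trans x≈y (sym (element-index y))))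

    index-element : ∀ i → index (element i) ≡ i
    index-element i = injective (element-index (element i))

    zeroIndex : Fin (suc n)
    zeroIndex = index 0#

    element≈0⇒zeroIndex : ∀ {i} → element i ≈ 0# → i ≡ zeroIndex
    element≈0⇒zeroIndex {i} eᵢ≈0 = ≡.trans (≡.sym (index-element i)) (index-cong eᵢ≈0)

    unit : Fin n → Carrier
    unit j = element (punchIn zeroIndex j)

    unit≉0 : ∀ j → ¬ unit j ≈ 0#
    unit≉0 j = punchInᵢ≢i zeroIndex j ∘ element≈0⇒zeroIndex

    scaleBy : Carrier → Fin (suc n) → Fin (suc n)
    scaleBy a i = index (a · element i)

    scaleBy-inverse : ∀ {a b} → a · b ≈ 1# → ∀ i → scaleBy a (scaleBy b i) ≡ i
    scaleBy-inverse {a} {b} ab≈1 i = ≡.trans (index-cong (begin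
      a · element (index (b · element i)) ≈⟨ *-congˡ (element-index _) ⟩
      a · (b · element i)                 ≈⟨ *-assoc a b _ ⟨
      (a · b) · element i                 ≈⟨ *-congʳ ab≈1 ⟩
      1# · element i                      ≈⟨ *-identityˡ _ ⟩
      element i                           ∎)) (index-element i)

    module Scaling {x} (x≉0 : ¬ x ≈ 0#) where
      scaling : Permutation (suc n) (suc n)
      scaling = permutation (scaleBy x) (scaleBy (x ⁻¹))
        (scaleBy-inverse (inverse x x≉0)) (scaleBy-inverse (trans (*-comm _ _) (inverse x x≉0)))

      scaling-zeroIndex : scaling ⟨$⟩ʳ zeroIndex ≡ zeroIndex
      scaling-zeroIndex = index-cong (trans (*-congˡ (element-index 0#)) (zeroʳ x))

      unitScaling : Permutation n n
      unitScaling = Permutation.remove zeroIndex scaling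

      unit-unitScaling : ∀ j → unit (unitScaling ⟨$⟩ʳ j) ≈ x · unit j
      unit-unitScaling j = begin
        element (punchIn zeroIndex (unitScaling ⟨$⟩ʳ j))
          ≡⟨ ≡.cong (λ i → element (punchIn i (unitScaling ⟨$⟩ʳ j))) scaling-zeroIndex ⟨
        element (punchIn (scaling ⟨$⟩ʳ zeroIndex) (unitScaling ⟨$⟩ʳ j))
          ≡⟨ ≡.cong element (Permutation.punchIn-permute scaling zeroIndex j) ⟨
        element (scaling ⟨$⟩ʳ punchIn zeroIndex j)
          ≈⟨ element-index _ ⟩
        x · unit j ∎

    -- Multiplication by x permutes the nonzero elements, so x^n ∏ unit = ∏ unit.
    pow-pred-card : ∀ {x} → ¬ x ≈ 0# → pow K x n ≈ 1#
    pow-pred-card {x} x≉0 = sym (*-cancelʳ (product-≉0 unit unit≉0) (begin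
      1# · product unit                         ≈⟨ *-identityˡ _ ⟩
      product unit                              ≈⟨ product-permute unit unitScaling ⟩
      product (unit ∘ (unitScaling ⟨$⟩ʳ_))      ≈⟨ product-cong unit-unitScaling ⟩
      product (λ j → x · unit j)                ≈⟨ product-distrib (replicate n x) unit ⟩
      product (replicate n x) · product unit     ≈⟨ *-congʳ (product-replicate n) ⟩
      x ^ᴷ n · product unit                     ≡⟨ ≡.cong (_· product unit) (pow≡^ x n) ⟨
      pow K x n · product unit                  ∎))
      where open Scaling x≉0

    pow-suc-card : ∀ x → pow K x (suc n) ≈ x
    pow-suc-card x with index x ≟ zeroIndex
    ... | yes xᵢ≡0ᵢ = trans (*-congʳ x≈0) (trans (zeroˡ _) (sym x≈0))
      where
      x≈0 : x ≈ 0#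
      x≈0 = trans (sym (element-index x)) (trans (reflexive (≡.cong element xᵢ≡0ᵢ)) (element-index 0#))
    ... | no  xᵢ≢0ᵢ = trans (*-congˡ (pow-pred-card (xᵢ≢0ᵢ ∘ index-cong))) (*-identityʳ x)

  pow-card : ∀ {N} → HasCard K N → ∀ x → pow K x N ≈ x
  pow-card {zero}  card x with () ← proj₁ (Bijection.strictlySurjective card x)
  pow-card {suc n} card   = Finite.pow-suc-card card

  InSubfield-pow : ∀ {q a x} → InSubfield K q a x → ∀ k → InSubfield K q a (pow K x k)
  InSubfield-pow {q} {a} {x} x∈F k = begin
    pow K (pow K x k) (q ^ a)  ≈⟨ pow-assocʳ x k (q ^ a) ⟩
    pow K x (k * q ^ a)        ≡⟨ ≡.cong (pow K x) (ℕ.*-comm k (q ^ a)) ⟩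
    pow K x (q ^ a * k)        ≈⟨ pow-assocʳ x (q ^ a) k ⟨
    pow K (pow K x (q ^ a)) k  ≈⟨ pow-congˡ k x∈F ⟩
    pow K x k                  ∎

  InSubfield-multiple : ∀ {q a x} → InSubfield K q a x → ∀ m → InSubfield K q (m * a) x
  InSubfield-multiple x∈F zero = pow-identityʳ _
  InSubfield-multiple {q} {a} {x} x∈F (suc m) = begin
    pow K x (q ^ (a + m * a))              ≡⟨ ≡.cong (pow K x) (ℕ.^-distribˡ-+-* q a (m * a)) ⟩
    pow K x (q ^ a * q ^ (m * a))          ≈⟨ pow-assocʳ x (q ^ a) (q ^ (m * a)) ⟨
    pow K (pow K x (q ^ a)) (q ^ (m * a))  ≈⟨ pow-congˡ (q ^ (m * a)) x∈F ⟩
    pow K x (q ^ (m * a))                  ≈⟨ InSubfield-multiple x∈F m ⟩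
    x                                      ∎

  InSubfield-bézout : ∀ {q a b k m x} → InSubfield K q a x → InSubfield K q b x →
                      1 + k * b ≡ m * a → InSubfield K q 1 x
  InSubfield-bézout {q} {a} {b} {k} {m} {x} x∈Fa x∈Fb 1+kb≡ma = begin
    pow K x (q ^ 1)                  ≡⟨ ≡.cong (pow K x) (ℕ.*-identityʳ q) ⟩
    pow K x q                        ≈⟨ InSubfield-multiple {a = b} (InSubfield-pow {a = b} x∈Fb q) k ⟨
    pow K (pow K x q) (q ^ (k * b))  ≈⟨ pow-assocʳ x q (q ^ (k * b)) ⟩
    pow K x (q ^ (1 + k * b))        ≡⟨ ≡.cong (λ e → pow K x (q ^ e)) 1+kb≡ma ⟩
    pow K x (q ^ (m * a))            ≈⟨ InSubfield-multiple x∈Fa m ⟩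
    x                                ∎

  InSubfield-coprime : ∀ {q a b x} → InSubfield K q a x → InSubfield K q b x → Coprime a b →
                       InSubfield K q 1 x
  InSubfield-coprime {a = a} {b = b} x∈Fa x∈Fb a⊥b with coprime-Bézout a⊥b
  ... | Bézout.+- m k 1+kb≡ma = InSubfield-bézout {a = a} {b = b} {k = k} {m = m} x∈Fa x∈Fb 1+kb≡ma
  ... | Bézout.-+ m k 1+ma≡kb = InSubfield-bézout {a = b} {b = a} {k = m} {m = k} x∈Fb x∈Fa 1+ma≡kb

  -- If (-1)^q = 1 rather than -1, then -1 = (-1)^{q^m} = 1 anyway.
  -1-InSubfield-1 : ∀ {q} m → .{{NonZero m}} → InSubfield K q m (- 1#) → InSubfield K q 1 (- 1#)
  -1-InSubfield-1 {q} (suc k) -1∈F with -1-pow q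
  ... | inj₂ -1^q≈-1 = trans (reflexive (≡.cong (pow K (- 1#)) (ℕ.*-identityʳ q))) -1^q≈-1
  ... | inj₁ -1^q≈1  = trans (reflexive (≡.cong (pow K (- 1#)) (ℕ.*-identityʳ q))) (trans -1^q≈1 (sym -1≈1))
    where
    -1≈1 : - 1# ≈ 1#
    -1≈1 = begin
      - 1#                            ≈⟨ -1∈F ⟨
      pow K (- 1#) (q * q ^ k)        ≈⟨ pow-assocʳ (- 1#) q (q ^ k) ⟨
      pow K (pow K (- 1#) q) (q ^ k)  ≈⟨ pow-congˡ (q ^ k) -1^q≈1 ⟩
      pow K 1# (q ^ k)                ≈⟨ 1#-pow (q ^ k) ⟩
      1#                              ∎

  norm≈1 : ∀ T {δ w} → ¬ w ≈ 0# → pow K w T ≈ - (δ · w) → pow K w (T * T) ≈ w →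
           pow K (- 1#) T ≈ - 1# → pow K δ (T + 1) ≈ 1#
  norm≈1 T {δ} {w} w≉0 wᵀ≈-δw wᵀᵀ≈w -1ᵀ≈-1 = *-cancelʳ (pow-≉0 w≉0 (T + 1)) (begin
    pow K δ (T + 1) · pow K w (T + 1)            ≈⟨ pow-distrib-* δ w (T + 1) ⟨
    pow K (δ · w) (T + 1)                        ≈⟨ *-identityˡ _ ⟨
    1# · pow K (δ · w) (T + 1)                   ≈⟨ *-congʳ -1ᵀ⁺¹≈1 ⟨
    pow K (- 1#) (T + 1) · pow K (δ · w) (T + 1) ≈⟨ pow-distrib-* (- 1#) (δ · w) (T + 1) ⟨
    pow K (- 1# · (δ · w)) (T + 1)               ≈⟨ pow-congˡ (T + 1) (trans (-1*x≈-x _) (sym wᵀ≈-δw)) ⟩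
    pow K (pow K w T) (T + 1)                    ≈⟨ pow-assocʳ w T (T + 1) ⟩
    pow K w (T * (T + 1))                        ≡⟨ ≡.cong (pow K w) T*[T+1]≡T*T+T ⟩
    pow K w (T * T + T)                          ≈⟨ pow-homo-* w (T * T) T ⟩
    pow K w (T * T) · pow K w T                  ≈⟨ *-congʳ wᵀᵀ≈w ⟩
    w · pow K w T                                ≡⟨ ≡.cong (pow K w) (ℕ.+-comm 1 T) ⟩
    pow K w (T + 1)                              ≈⟨ *-identityˡ _ ⟨
    1# · pow K w (T + 1)                         ∎)
    where
    -1ᵀ⁺¹≈1 : pow K (- 1#) (T + 1) ≈ 1#
    -1ᵀ⁺¹≈1 = begin
      pow K (- 1#) (T + 1)              ≈⟨ pow-homo-* (- 1#) T 1 ⟩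
      pow K (- 1#) T · pow K (- 1#) 1   ≈⟨ *-cong -1ᵀ≈-1 (pow-identityʳ (- 1#)) ⟩
      - 1# · - 1#                       ≈⟨ -1*x≈-x (- 1#) ⟩
      - (- 1#)                          ≈⟨ -‿involutive 1# ⟩
      1#                                ∎
    T*[T+1]≡T*T+T : T * (T + 1) ≡ T * T + T
    T*[T+1]≡T*T+T = ≡.trans (ℕ.*-distribˡ-+ T T 1) (≡.cong (T * T +_) (ℕ.*-identityʳ T))

  module LinearizedBinomial (q t s : ℕ) (δ : Carrier) where
    f : Carrier → Carrier
    f x = δ · pow K x (q ^ s) ⊕ pow K x (q ^ (t + s))

    f-cong : ∀ {x y} → x ≈ y → f x ≈ f y
    f-cong x≈y = +-cong (*-congˡ (pow-congˡ (q ^ s) x≈y)) (pow-congˡ (q ^ (t + s)) x≈y)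

    pow-q^[t+s] : ∀ x → pow K x (q ^ (t + s)) ≈ pow K (pow K x (q ^ s)) (q ^ t)
    pow-q^[t+s] x = trans
      (reflexive (≡.cong (pow K x) (≡.trans (ℕ.^-distribˡ-+-* q t s) (ℕ.*-comm (q ^ t) (q ^ s)))))
      (sym (pow-assocʳ x (q ^ s) (q ^ t)))

    f-semilinear : ∀ {μ} → InSubfield K q t μ → ∀ z → f (μ · z) ≈ pow K μ (q ^ s) · f z
    f-semilinear {μ} μ∈F z = begin
      δ · pow K (μ · z) Q ⊕ pow K (μ · z) Q′
        ≈⟨ +-cong (*-congˡ (pow-distrib-* μ z Q)) (pow-distrib-* μ z Q′) ⟩
      δ · (pow K μ Q · pow K z Q) ⊕ pow K μ Q′ · pow K z Q′
        ≈⟨ +-cong (x∙yz≈y∙xz δ (pow K μ Q) (pow K z Q)) (*-congʳ μ^Q′≈μ^Q) ⟩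
      pow K μ Q · (δ · pow K z Q) ⊕ pow K μ Q · pow K z Q′
        ≈⟨ distribˡ (pow K μ Q) _ _ ⟨
      pow K μ Q · f z
        ∎
      where
      Q Q′ : ℕ
      Q  = q ^ s
      Q′ = q ^ (t + s)
      μ^Q′≈μ^Q : pow K μ Q′ ≈ pow K μ Q
      μ^Q′≈μ^Q = trans (pow-q^[t+s] μ) (InSubfield-pow {a = t} μ∈F Q)

    f-root⇒norm≈1 : (∀ x → InSubfield K q (2 * t) x) → InSubfield K q 1 (- 1#) →
                    ∀ {z} → ¬ z ≈ 0# → f z ≈ 0# → pow K δ (q ^ t + 1) ≈ 1#
    f-root⇒norm≈1 K⊆F -1∈F {z} z≉0 fz≈0 =
      norm≈1 (q ^ t) (pow-≉0 z≉0 (q ^ s)) wᵀ≈-δw wᵀᵀ≈w -1ᵀ≈-1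
      where
      w : Carrier
      w = pow K z (q ^ s)
      wᵀ≈-δw : pow K w (q ^ t) ≈ - (δ · w)
      wᵀ≈-δw = +-inverseʳ-unique (δ · w) _ (trans (+-congˡ (sym (pow-q^[t+s] z))) fz≈0)
      q^2t≡q^t*q^t : q ^ (2 * t) ≡ q ^ t * q ^ t
      q^2t≡q^t*q^t = ≡.trans (≡.cong (λ e → q ^ (t + e)) (ℕ.+-identityʳ t)) (ℕ.^-distribˡ-+-* q t t)
      wᵀᵀ≈w : pow K w (q ^ t * q ^ t) ≈ w
      wᵀᵀ≈w = trans (reflexive (≡.cong (pow K w) (≡.sym q^2t≡q^t*q^t))) (K⊆F w)
      -1ᵀ≈-1 : pow K (- 1#) (q ^ t) ≈ - 1#
      -1ᵀ≈-1 = ≡.subst (λ m → InSubfield K q m (- 1#)) (ℕ.*-identityʳ t) (InSubfield-multiple -1∈F t)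

proposition2p12 : ∀ {c ℓ} (q t s : ℕ) → IsPrimePower q → 2 ≤ t → 1 ≤ s → Coprime s (2 * t) →
  (K : Field c ℓ) → HasCard K (q ^ (2 * t)) →
  (δ : Field.Carrier K) →
  ¬ (Field._≈_ K (pow K δ (q ^ t + 1)) (Field.1# K)) →
  RPartiallyScattered K q t
    (λ x → Field._+_ K (Field._*_ K δ (pow K x (q ^ s))) (pow K x (q ^ (t + s))))
proposition2p12 q t@(suc _) s _ _ _ s⊥2t K card δ Nδ≉1 y z y≉0 z≉0 fy/y≈fz/z μ∈Fₜ =
  InSubfield-coprime μ∈Fₛ μ∈Fₜ s⊥t
  where
  open Field K using (_≈_; _⁻¹; 0#; 1#; -_; setoid) renaming (_*_ to _·_)
  open FieldProperties K
  open LinearizedBinomial q t s δ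
  open import Relation.Binary.Reasoning.Setoid setoid

  μ : Field.Carrier K
  μ = y · z ⁻¹

  fz≉0 : ¬ f z ≈ 0#
  fz≉0 = Nδ≉1 ∘ f-root⇒norm≈1 (pow-card card) (-1-InSubfield-1 {q} (2 * t) (pow-card card (- 1#))) z≉0

  μ∈Fₛ : InSubfield K q s μ
  μ∈Fₛ = *-cancelʳ fz≉0 (begin
    pow K μ (q ^ s) · f z  ≈⟨ f-semilinear μ∈Fₜ z ⟨
    f (μ · z)              ≈⟨ f-cong (x≈[x*z⁻¹]*z z≉0) ⟨
    f y                    ≈⟨ quotients-equal⇒ y≉0 fy/y≈fz/z ⟩
    μ · f z                ∎)

  s⊥t : Coprime s t
  s⊥t (d∣s , d∣t) = s⊥2t (d∣s , ∣-trans d∣t (n∣m*n 2))
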